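{- Every polynomial $p(x_1,\dots,x_n)$ computed by an arithmetic formula can be represented as an affine projection of a DPP: there exist $N$, a constant matrix $L\in\mathbb{F}^{N\times N}$ and affine linear forms $\ell_1,\dots,\ell_N$ in $x_1,\dots,x_n$ such that $p=\det\big(L+\mathrm{diag}(\ell_1,\dots,\ell_N)\big)$.
   Context: An arithmetic formula is an arithmetic circuit (input nodes labeled by variables or field constants, internal addition and multiplication gates) whose underlying graph is a tree. A determinantal point process (DPP), viewed as a polynomial, is $\det(L+\mathbf{X})$, where $L$ is a constant $N\times N$ matrix and $\mathbf{X}=\mathrm{diag}(y_1,\dots,y_N)$ is a diagonal matrix of variables. An affine projection maps each variable $y_j$ to an affine linear form in (a subset of) the variables $x_1,\dots,x_n$. $\mathbb{F}$ denotes the underlying field (e.g. $\mathbb{Q}$ or $\mathbb{R}$); positive semidefiniteness of $L$ is not required. -}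

module Defs where

open import Level using (Level; _⊔_) renaming (suc to lsuc)
open import Data.Nat using (ℕ; zero; suc)
open import Data.Fin using (Fin; zero; suc; punchIn; toℕ; _≟_)
open import Data.Product using (Σ; _,_)
open import Relation.Nullary using (¬_; yes; no)
open import Algebra.Bundles using (CommutativeRing)

record Field (c ℓ : Level) : Set (lsuc (c ⊔ ℓ)) where
  field
    commutativeRing : CommutativeRing c ℓ
  open CommutativeRing commutativeRing public
  field
    1≉0     : ¬ (1# ≈ 0#)
    inverse : ∀ x → ¬ (x ≈ 0#) → Σ Carrier (λ y → (x * y) ≈ 1#)

module _ {c ℓ : Level} (F : Field c ℓ) where
  open Field F using (Carrier; _≈_; _+_; _*_; -_; 0#; 1#)

  -- As a syntax tree this is exactly an arithmetic formula (leaves are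
  -- variables or field constants, internal nodes are + and × gates).
  data Expr (n : ℕ) : Set c where
    var : Fin n → Expr n
    con : Carrier → Expr n
    _⊕_ : Expr n → Expr n → Expr n
    _⊗_ : Expr n → Expr n → Expr n

  infixl 6 _⊕_
  infixl 7 _⊗_

  Formula : ℕ → Set c
  Formula = Expr

  -- Expr n / _≃_ is the polynomial ring
  -- F[x_0,...,x_{n-1}] (free commutative F-algebra on n generators).
  infix 4 _≃_
  data _≃_ {n : ℕ} : Expr n → Expr n → Set (c ⊔ ℓ) where
    ≃-refl  : ∀ {p} → p ≃ p
    ≃-sym   : ∀ {p q} → p ≃ q → q ≃ p
    ≃-trans : ∀ {p q r} → p ≃ q → q ≃ r → p ≃ r
    ⊕-cong  : ∀ {p p' q q'} → p ≃ p' → q ≃ q' → p ⊕ q ≃ p' ⊕ q'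
    ⊗-cong  : ∀ {p p' q q'} → p ≃ p' → q ≃ q' → p ⊗ q ≃ p' ⊗ q'
    ⊕-assoc : ∀ p q r → (p ⊕ q) ⊕ r ≃ p ⊕ (q ⊕ r)
    ⊕-comm  : ∀ p q → p ⊕ q ≃ q ⊕ p
    ⊕-idˡ   : ∀ p → con 0# ⊕ p ≃ p
    ⊗-assoc : ∀ p q r → (p ⊗ q) ⊗ r ≃ p ⊗ (q ⊗ r)
    ⊗-comm  : ∀ p q → p ⊗ q ≃ q ⊗ p
    ⊗-idˡ   : ∀ p → con 1# ⊗ p ≃ p
    ⊗-zeroˡ : ∀ p → con 0# ⊗ p ≃ con 0#
    ⊗-⊕-distribˡ : ∀ p q r → p ⊗ (q ⊕ r) ≃ (p ⊗ q) ⊕ (p ⊗ r)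
    con-cong : ∀ {a b} → a ≈ b → con a ≃ con b
    con-+   : ∀ a b → con a ⊕ con b ≃ con (a + b)
    con-*   : ∀ a b → con a ⊗ con b ≃ con (a * b)

  sign : ∀ {n} → ℕ → Expr n
  sign zero    = con 1#
  sign (suc k) = con (- 1#) ⊗ sign k

  sumE : ∀ {n} (m : ℕ) → (Fin m → Expr n) → Expr n
  sumE zero    f = con 0#
  sumE (suc m) f = f zero ⊕ sumE m (λ i → f (suc i))

  det : ∀ {n} (N : ℕ) → (Fin N → Fin N → Expr n) → Expr n
  det zero    M = con 1#
  det (suc N) M =
    sumE (suc N) (λ j → sign (toℕ j) ⊗ M zero j
                          ⊗ det N (λ i k → M (suc i) (punchIn j k)))

  record Affine (n : ℕ) : Set c where
    constructor affine
    field
      const  : Carrier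
      coeffs : Fin n → Carrier

  ⟦_⟧A : ∀ {n} → Affine n → Expr n
  ⟦ affine c₀ a ⟧A = con c₀ ⊕ sumE _ (λ i → con (a i) ⊗ var i)

  LplusDiag : ∀ {n} (N : ℕ) → (Fin N → Fin N → Carrier) → (Fin N → Affine n)
            → Fin N → Fin N → Expr n
  LplusDiag N L ℓs i j with i ≟ j
  ... | yes _ = con (L i j) ⊕ ⟦ ℓs i ⟧A
  ... | no  _ = con (L i j)

-- Expanding along the first row, the determinant of a lower Hessenberg matrix
-- with -1 on the superdiagonal and 0 above it obeys
--   V_k = d_k V_{k+1} + Σ_i c_k(i) V_{k+2+i},
-- where V_k is the determinant of the trailing principal submatrix from k on,
-- d_k its diagonal entry and c_k(i) the entry i+1 rows below it.  So the
-- columns form a straight-line program in which each value is the next one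
-- times an affine form plus constant multiples of later ones.  Formulas compile
-- into such programs in continuation-passing style, the code for φ with
-- continuation r having value φ times the value r columns past its end: a
-- product chains the code of its factors, and a sum places the code of ψ
-- (continuing past the code of φ) in front of the code of φ, preceded by one
-- column adding the two starting values.  Only the diagonal involves
-- variables, and only affinely, so the matrix is L + diag(ℓ₁, …, ℓ_N).
module Submission where

open import Defs
open import Level using (Level; _⊔_)
open import Data.Nat using (ℕ; zero; suc; _+_; _≤_; z≤n; s≤s)
open import Data.Nat.Properties using (+-identityʳ; +-monoʳ-≤; ≤-trans; ≤-reflexive)
open import Data.Fin using (Fin; zero; suc; toℕ; punchIn; _≟_)
open import Data.Empty using (⊥-elim)
open import Data.Product using (Σ; _,_)
open import Data.List using (List; []; _∷_; _++_; length; drop)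
open import Data.List.Properties using (++-assoc; ++-identityʳ; length-++; length-++-≤ˡ)
open import Function using (_∘_)
open import Relation.Binary.Bundles using (Setoid)
open import Relation.Binary.PropositionalEquality using (_≡_; _≢_; refl; sym; trans; cong)
open import Relation.Nullary using (yes; no)
import Algebra.Properties.Ring as RingProperties

module _ {c ℓ : Level} (F : Field c ℓ) {n : ℕ} where
  open Field F using (Carrier; -_; 0#; 1#; ring) renaming (_+_ to _+ᶠ_)

  Ex : Set c
  Ex = Expr F n

  infix 4 _≋_
  _≋_ : Ex → Ex → Set (c ⊔ ℓ)
  _≋_ = _≃_ F

  ≋-setoid : Setoid c (c ⊔ ℓ)
  ≋-setoid = record
    { Carrier       = Ex
    ; _≈_           = _≋_
    ; isEquivalence = record { refl = ≃-refl ; sym = ≃-sym ; trans = ≃-trans }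
    }

  open import Relation.Binary.Reasoning.Setoid ≋-setoid

  ⊕-idʳ : ∀ p → p ⊕ con 0# ≋ p
  ⊕-idʳ p = ≃-trans (⊕-comm p _) (⊕-idˡ p)

  ⊗-idʳ : ∀ p → p ⊗ con 1# ≋ p
  ⊗-idʳ p = ≃-trans (⊗-comm p _) (⊗-idˡ p)

  ⊗-zeroʳ : ∀ p → p ⊗ con 0# ≋ con 0#
  ⊗-zeroʳ p = ≃-trans (⊗-comm p _) (⊗-zeroˡ p)

  ⊗-⊕-distribʳ : ∀ p q r → (p ⊕ q) ⊗ r ≋ p ⊗ r ⊕ q ⊗ r
  ⊗-⊕-distribʳ p q r = begin
    (p ⊕ q) ⊗ r        ≈⟨ ⊗-comm _ r ⟩
    r ⊗ (p ⊕ q)        ≈⟨ ⊗-⊕-distribˡ r p q ⟩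
    r ⊗ p ⊕ r ⊗ q      ≈⟨ ⊕-cong (⊗-comm r p) (⊗-comm r q) ⟩
    p ⊗ r ⊕ q ⊗ r      ∎

  sign1⊗minus1≋1 : sign F 1 ⊗ con (- 1#) ≋ con 1#
  sign1⊗minus1≋1 =
    ≃-trans (⊗-cong (con-* _ _) ≃-refl) (≃-trans (con-* _ _) (con-cong minus1²≈1))
    where
    open Field F using (_*_; _≈_; *-congʳ; *-identityʳ) renaming (trans to ≈-trans)
    open RingProperties ring using (-1*x≈-x; -‿involutive)
    minus1²≈1 : (- 1# * 1#) * - 1# ≈ 1#
    minus1²≈1 = ≈-trans (*-congʳ (*-identityʳ _)) (≈-trans (-1*x≈-x _) (-‿involutive _))

  sumE-cong : ∀ m {f g : Fin m → Ex} → (∀ i → f i ≋ g i) → sumE F m f ≋ sumE F m g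
  sumE-cong zero    f≋g = ≃-refl
  sumE-cong (suc m) f≋g = ⊕-cong (f≋g zero) (sumE-cong m (f≋g ∘ suc))

  sumE-zero : ∀ m {f : Fin m → Ex} → (∀ i → f i ≋ con 0#) → sumE F m f ≋ con 0#
  sumE-zero zero    f≋0 = ≃-refl
  sumE-zero (suc m) f≋0 = ≃-trans (⊕-cong (f≋0 zero) (sumE-zero m (f≋0 ∘ suc))) (⊕-idˡ _)

  det-cong : ∀ N {A B : Fin N → Fin N → Ex} → (∀ i j → A i j ≋ B i j) → det F N A ≋ det F N B
  det-cong zero    A≋B = ≃-refl
  det-cong (suc N) A≋B = sumE-cong (suc N) λ j →
    ⊗-cong (⊗-cong (≃-refl {p = sign F (toℕ j)}) (A≋B zero j)) (det-cong N λ i k → A≋B (suc i) (punchIn j k))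

  module Hessenberg {a} {A : Set a} (diagonal : A → Ex) (below : A → ℕ → Ex) where

    topRow : ∀ {m} → Fin m → Carrier
    topRow zero    = - 1#
    topRow (suc _) = 0#

    firstColumn : A → ℕ → Ex
    firstColumn x zero    = diagonal x
    firstColumn x (suc i) = below x i

    mutual
      hessenberg : (xs : List A) → Fin (length xs) → Fin (length xs) → Ex
      hessenberg []       () j
      hessenberg (x ∷ xs) i  j = bordered (firstColumn x) xs i j

      bordered : (ℕ → Ex) → (xs : List A) → Fin (suc (length xs)) → Fin (suc (length xs)) → Ex
      bordered f xs i zero    = f (toℕ i)
      bordered f xs i (suc j) = tailColumns xs i j

      tailColumns : (xs : List A) → Fin (suc (length xs)) → Fin (length xs) → Ex
      tailColumns xs zero    j = con (topRow j)
      tailColumns xs (suc i) j = hessenberg xs i j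

    mutual
      continuant : List A → Ex
      continuant []       = con 1#
      continuant (x ∷ xs) = diagonal x ⊗ continuant xs ⊕ feedSum (below x) xs

      feedSum : (ℕ → Ex) → List A → Ex
      feedSum f []       = con 0#
      feedSum f (x ∷ xs) = f 0 ⊗ continuant xs ⊕ feedSum (f ∘ suc) xs

    mutual
      det-hessenberg : ∀ xs → det F (length xs) (hessenberg xs) ≋ continuant xs
      det-hessenberg []       = ≃-refl
      det-hessenberg (x ∷ xs) = det-bordered (firstColumn x) xs

      -- The first row is (f 0, -1, 0, …, 0), so only two cofactors survive.
      det-bordered : ∀ f xs →
        det F (suc (length xs)) (bordered f xs) ≋ f 0 ⊗ continuant xs ⊕ feedSum (f ∘ suc) xs
      det-bordered f []       = ⊕-cong (⊗-cong (⊗-idˡ (f 0)) ≃-refl) ≃-refl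
      det-bordered f (x ∷ xs) = begin
        det F (suc (suc (length xs))) (bordered f (x ∷ xs))
          ≈⟨ ⊕-cong (⊗-cong (⊗-idˡ (f 0)) (det-hessenberg (x ∷ xs)))
                    (⊕-cong secondCofactor (sumE-zero (length xs) λ _ →
                      ≃-trans (⊗-cong (⊗-zeroʳ _) ≃-refl) (⊗-zeroˡ _))) ⟩
        f 0 ⊗ continuant (x ∷ xs) ⊕ (feedSum (f ∘ suc) (x ∷ xs) ⊕ con 0#)
          ≈⟨ ⊕-cong ≃-refl (⊕-idʳ _) ⟩
        f 0 ⊗ continuant (x ∷ xs) ⊕ feedSum (f ∘ suc) (x ∷ xs) ∎
        where
        minor≋bordered : ∀ i k →
          bordered f (x ∷ xs) (suc i) (punchIn (suc zero) k) ≋ bordered (f ∘ suc) xs i k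
        minor≋bordered i zero    = ≃-refl
        minor≋bordered i (suc k) = ≃-refl

        secondCofactor : sign F 1 ⊗ con (- 1#) ⊗ det F (suc (length xs))
                           (λ i k → bordered f (x ∷ xs) (suc i) (punchIn (suc zero) k))
                         ≋ feedSum (f ∘ suc) (x ∷ xs)
        secondCofactor =
          ≃-trans (⊗-cong sign1⊗minus1≋1 (det-cong (suc (length xs)) minor≋bordered))
                  (≃-trans (⊗-idˡ _) (det-bordered (f ∘ suc) xs))

  record Column : Set c where
    constructor column
    field
      form   : Affine F n
      below  : ℕ → Carrier

  ⟦_⟧ : Affine F n → Ex
  ⟦_⟧ = ⟦_⟧A F

  open Hessenberg (λ s → ⟦ Column.form s ⟧) (λ s i → con (Column.below s i))

  value : List Column → ℕ → Ex
  value ps r = continuant (drop r ps)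

  value-++ : ∀ qs {ps} r → value (qs ++ ps) (length qs + r) ≡ value ps r
  value-++ []       r = refl
  value-++ (q ∷ qs) r = value-++ qs r

  basis : ℕ → ℕ → Carrier
  basis zero    zero    = 1#
  basis zero    (suc _) = 0#
  basis (suc _) zero    = 0#
  basis (suc r) (suc i) = basis r i

  sumE-basis : ∀ m (v : Fin m → Ex) x →
    sumE F m (λ i → con (basis (toℕ x) (toℕ i)) ⊗ v i) ≋ v x
  sumE-basis (suc m) v zero    =
    ≃-trans (⊕-cong (⊗-idˡ _) (sumE-zero m λ _ → ⊗-zeroˡ _)) (⊕-idʳ _)
  sumE-basis (suc m) v (suc x) =
    ≃-trans (⊕-cong (⊗-zeroˡ _) (sumE-basis m (v ∘ suc) x)) (⊕-idˡ _)

  constant : Carrier → Affine F n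
  constant a = affine a (λ _ → 0#)

  coordinate : Fin n → Affine F n
  coordinate x = affine 0# (basis (toℕ x) ∘ toℕ)

  ⟦constant⟧ : ∀ a → ⟦ constant a ⟧ ≋ con a
  ⟦constant⟧ a = ≃-trans (⊕-cong ≃-refl (sumE-zero n λ _ → ⊗-zeroˡ _)) (⊕-idʳ _)

  ⟦coordinate⟧ : ∀ x → ⟦ coordinate x ⟧ ≋ var x
  ⟦coordinate⟧ x = ≃-trans (⊕-cong ≃-refl (sumE-basis n var x)) (⊕-idˡ _)

  feedSum-zero : ∀ ps → feedSum (λ _ → con 0#) ps ≋ con 0#
  feedSum-zero []       = ≃-refl
  feedSum-zero (p ∷ ps) = ≃-trans (⊕-cong (⊗-zeroˡ _) (feedSum-zero ps)) (⊕-idˡ _)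

  feedSum-basis : ∀ r ps → suc r ≤ length ps → feedSum (con ∘ basis r) ps ≋ value ps (suc r)
  feedSum-basis zero    (p ∷ ps) _        = ≃-trans (⊕-cong (⊗-idˡ _) (feedSum-zero ps)) (⊕-idʳ _)
  feedSum-basis (suc r) (p ∷ ps) (s≤s r<) =
    ≃-trans (⊕-cong (⊗-zeroˡ _) (feedSum-basis r ps r<)) (⊕-idˡ _)

  scale : Affine F n → Column
  scale a = column a (λ _ → 0#)

  -- Reaching the value m columns further on takes a constant below the
  -- diagonal when m ≥ 1; for m = 0 it is folded into the diagonal entry.
  link : Carrier → ℕ → Column
  link e zero    = scale (constant (e +ᶠ 1#))
  link e (suc m) = column (constant e) (basis m)

  continuant-scale : ∀ a ps → continuant (scale a ∷ ps) ≋ ⟦ a ⟧ ⊗ continuant ps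
  continuant-scale a ps = ≃-trans (⊕-cong ≃-refl (feedSum-zero ps)) (⊕-idʳ _)

  continuant-link : ∀ e m ps → m ≤ length ps →
    continuant (link e m ∷ ps) ≋ con e ⊗ continuant ps ⊕ value ps m
  continuant-link e zero    ps _  = begin
    continuant (link e zero ∷ ps)          ≈⟨ continuant-scale _ ps ⟩
    ⟦ constant (e +ᶠ 1#) ⟧ ⊗ continuant ps
      ≈⟨ ⊗-cong (≃-trans (⟦constant⟧ _) (≃-sym (con-+ e 1#))) ≃-refl ⟩
    (con e ⊕ con 1#) ⊗ continuant ps       ≈⟨ ⊗-⊕-distribʳ _ _ _ ⟩
    con e ⊗ continuant ps ⊕ con 1# ⊗ continuant ps
      ≈⟨ ⊕-cong ≃-refl (⊗-idˡ _) ⟩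
    con e ⊗ continuant ps ⊕ continuant ps  ∎
  continuant-link e (suc m) ps m< =
    ⊕-cong (⊗-cong (⟦constant⟧ e) ≃-refl) (feedSum-basis m ps m<)

  continuant-leaf : ∀ a r ps → r ≤ length ps →
    continuant (scale a ∷ link 0# r ∷ ps) ≋ ⟦ a ⟧ ⊗ value ps r
  continuant-leaf a r ps r≤ = begin
    continuant (scale a ∷ link 0# r ∷ ps)        ≈⟨ continuant-scale a _ ⟩
    ⟦ a ⟧ ⊗ continuant (link 0# r ∷ ps)           ≈⟨ ⊗-cong ≃-refl (continuant-link 0# r ps r≤) ⟩
    ⟦ a ⟧ ⊗ (con 0# ⊗ continuant ps ⊕ value ps r) ≈⟨ ⊗-cong ≃-refl (⊕-cong (⊗-zeroˡ _) ≃-refl) ⟩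
    ⟦ a ⟧ ⊗ (con 0# ⊕ value ps r)                 ≈⟨ ⊗-cong ≃-refl (⊕-idˡ _) ⟩
    ⟦ a ⟧ ⊗ value ps r                            ∎

  compile : Ex → ℕ → List Column
  compile (var x) r = scale (coordinate x) ∷ link 0# r ∷ []
  compile (con a) r = scale (constant a) ∷ link 0# r ∷ []
  compile (φ ⊗ ψ) r = compile φ 0 ++ compile ψ r
  compile (φ ⊕ ψ) r = link 1# (length codeψ) ∷ codeψ ++ codeφ
    where
    codeφ = compile φ r
    codeψ = compile ψ (length codeφ + r)

  continuant-compile : ∀ φ r ps → r ≤ length ps →
    continuant (compile φ r ++ ps) ≋ φ ⊗ value ps r
  continuant-compile (var x) r ps r≤ =
    ≃-trans (continuant-leaf _ r ps r≤) (⊗-cong (⟦coordinate⟧ x) ≃-refl)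
  continuant-compile (con a) r ps r≤ =
    ≃-trans (continuant-leaf _ r ps r≤) (⊗-cong (⟦constant⟧ a) ≃-refl)
  continuant-compile (φ ⊗ ψ) r ps r≤ = begin
    continuant ((compile φ 0 ++ compile ψ r) ++ ps)
      ≡⟨ cong continuant (++-assoc (compile φ 0) _ ps) ⟩
    continuant (compile φ 0 ++ compile ψ r ++ ps)
      ≈⟨ continuant-compile φ 0 _ z≤n ⟩
    φ ⊗ continuant (compile ψ r ++ ps)
      ≈⟨ ⊗-cong ≃-refl (continuant-compile ψ r ps r≤) ⟩
    φ ⊗ (ψ ⊗ value ps r)
      ≈⟨ ⊗-assoc φ ψ _ ⟨
    φ ⊗ ψ ⊗ value ps r ∎
  continuant-compile (φ ⊕ ψ) r ps r≤ = begin
    continuant (link 1# (length codeψ) ∷ (codeψ ++ codeφ) ++ ps)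
      ≡⟨ cong (continuant ∘ (link 1# (length codeψ) ∷_)) (++-assoc codeψ codeφ ps) ⟩
    continuant (link 1# (length codeψ) ∷ codeψ ++ codeφ ++ ps)
      ≈⟨ continuant-link 1# (length codeψ) _ (length-++-≤ˡ codeψ) ⟩
    con 1# ⊗ continuant (codeψ ++ codeφ ++ ps) ⊕ value (codeψ ++ codeφ ++ ps) (length codeψ)
      ≡⟨ cong (con 1# ⊗ continuant (codeψ ++ codeφ ++ ps) ⊕_) valueAfterψ ⟩
    con 1# ⊗ continuant (codeψ ++ codeφ ++ ps) ⊕ continuant (codeφ ++ ps)
      ≈⟨ ⊕-cong (⊗-idˡ _) ≃-refl ⟩
    continuant (codeψ ++ codeφ ++ ps) ⊕ continuant (codeφ ++ ps)
      ≈⟨ ⊕-cong (continuant-compile ψ _ _ rψ≤) (continuant-compile φ r ps r≤) ⟩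
    ψ ⊗ value (codeφ ++ ps) (length codeφ + r) ⊕ φ ⊗ value ps r
      ≡⟨ cong (λ v → ψ ⊗ v ⊕ φ ⊗ value ps r) (value-++ codeφ r) ⟩
    ψ ⊗ value ps r ⊕ φ ⊗ value ps r
      ≈⟨ ⊕-comm _ _ ⟩
    φ ⊗ value ps r ⊕ ψ ⊗ value ps r
      ≈⟨ ⊗-⊕-distribʳ φ ψ _ ⟨
    (φ ⊕ ψ) ⊗ value ps r ∎
    where
    codeφ = compile φ r
    codeψ = compile ψ (length codeφ + r)

    rψ≤ : length codeφ + r ≤ length (codeφ ++ ps)
    rψ≤ = ≤-trans (+-monoʳ-≤ (length codeφ) r≤) (≤-reflexive (sym (length-++ codeφ)))

    valueAfterψ : value (codeψ ++ codeφ ++ ps) (length codeψ) ≡ continuant (codeφ ++ ps)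
    valueAfterψ = trans (cong (value _) (sym (+-identityʳ (length codeψ)))) (value-++ codeψ 0)

  compile-sound : ∀ φ → φ ≋ continuant (compile φ 0)
  compile-sound φ = begin
    φ                                   ≈⟨ ⊗-idʳ φ ⟨
    φ ⊗ con 1#                          ≈⟨ continuant-compile φ 0 [] z≤n ⟨
    continuant (compile φ 0 ++ [])      ≡⟨ cong continuant (++-identityʳ _) ⟩
    continuant (compile φ 0)            ∎

  constantPart : (ps : List Column) → Fin (length ps) → Fin (length ps) → Carrier
  constantPart (p ∷ ps) zero    zero    = 0#
  constantPart (p ∷ ps) zero    (suc j) = topRow j
  constantPart (p ∷ ps) (suc i) zero    = Column.below p (toℕ i)
  constantPart (p ∷ ps) (suc i) (suc j) = constantPart ps i j

  diagonalForms : (ps : List Column) → Fin (length ps) → Affine F n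
  diagonalForms (p ∷ ps) zero    = Column.form p
  diagonalForms (p ∷ ps) (suc i) = diagonalForms ps i

  hessenberg-diagonal : ∀ ps i → con (constantPart ps i i) ⊕ ⟦ diagonalForms ps i ⟧ ≋ hessenberg ps i i
  hessenberg-diagonal (p ∷ ps) zero    = ⊕-idˡ _
  hessenberg-diagonal (p ∷ ps) (suc i) = hessenberg-diagonal ps i

  hessenberg-offDiagonal : ∀ ps i j → i ≢ j → con (constantPart ps i j) ≋ hessenberg ps i j
  hessenberg-offDiagonal (p ∷ ps) zero    zero    i≢j = ⊥-elim (i≢j refl)
  hessenberg-offDiagonal (p ∷ ps) zero    (suc j) _   = ≃-refl
  hessenberg-offDiagonal (p ∷ ps) (suc i) zero    _   = ≃-refl
  hessenberg-offDiagonal (p ∷ ps) (suc i) (suc j) i≢j =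
    hessenberg-offDiagonal ps i j (i≢j ∘ cong suc)

  LplusDiag≋hessenberg : ∀ ps i j →
    LplusDiag F (length ps) (constantPart ps) (diagonalForms ps) i j ≋ hessenberg ps i j
  LplusDiag≋hessenberg ps i j with i ≟ j
  ... | yes refl = hessenberg-diagonal ps i
  ... | no  i≢j  = hessenberg-offDiagonal ps i j i≢j

  det-LplusDiag : ∀ ps →
    det F (length ps) (LplusDiag F (length ps) (constantPart ps) (diagonalForms ps)) ≋ continuant ps
  det-LplusDiag ps =
    ≃-trans (det-cong (length ps) (LplusDiag≋hessenberg ps)) (det-hessenberg ps)

theorem6 : ∀ {c ℓ : Level} (F : Field c ℓ) (n : ℕ) (φ : Formula F n) →
    Σ ℕ (λ N → Σ (Fin N → Fin N → Field.Carrier F) (λ L →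
    Σ (Fin N → Affine F n) (λ ℓs →
    _≃_ F φ (det F N (LplusDiag F N L ℓs)))))
theorem6 F n φ =
  length ps , constantPart F ps , diagonalForms F ps ,
  ≃-trans (compile-sound F φ) (≃-sym (det-LplusDiag F ps))
  where
  ps = compile F φ 0
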